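{- Suppose that every path of the implementation automaton $\mathcal Q$ starting from its initial state $q_0$ is a prefix of a legal quiescent path of $\mathcal Q$. If $\rho$ is a quiescent path of $\mathcal Q$ with $start(\rho) = q_0$ and $end(\rho) = q$, then all paths of $\mathcal Q$ starting from $q_0$ and ending in $q$ are quiescent.
   Context: A finite automaton (FA) is a tuple $(M,m_0,\Sigma,t,M_\dagger)$ with finite states $M$, initial state $m_0$, alphabet $\Sigma$, transition relation $t$ and final states $M_\dagger$; a path is a sequence of consecutive transitions, with start state, end state and label (the sequence of events). $\mathcal Q$ is an FA whose alphabet consists of invocation and response events, each associated with a process; an invocation matches a response iff they have the same process and operation. A run is sequential if (when non-empty) it starts with an invocation, each invocation at an even position $i<k$ is followed by its matching response, and a final event at an even position is an invocation; it is legal if its restriction to each process is sequential. All runs of $\mathcal Q$ are assumed legal. An invocation is pending in a run if no later event is a matching response; a run (or path, via its label) is quiescent if it has no pending invocations. -}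

module Defs where

open import Data.Nat using (ℕ)
open import Data.Fin using (Fin)
open import Data.Bool using (Bool; true; false)
open import Data.List using (List; []; _∷_; _++_; filter)
open import Data.List.Relation.Unary.Any using (Any)
open import Data.List.Relation.Unary.All using (All)
open import Data.Product using (_×_)
open import Relation.Binary.PropositionalEquality using (_≡_)
open import Relation.Binary.Definitions using (DecidableEquality)

record Alphabet : Set₁ where
  field
    Σ     : Set
    Proc  : Set
    Op    : Set
    isInv : Σ → Bool
    proc  : Σ → Proc
    op    : Σ → Op
    _≟P_  : DecidableEquality Proc

module _ (A : Alphabet) where
  open Alphabet A

  Match : Σ → Σ → Set
  Match i r = (isInv i ≡ true) × (isInv r ≡ false) × (proc i ≡ proc r) × (op i ≡ op r)

  data Sequential : List Σ → Set where
    seq-nil  : Sequential []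
    seq-one  : ∀ {i} → isInv i ≡ true → Sequential (i ∷ [])
    seq-pair : ∀ {i r w} → isInv i ≡ true → Match i r → Sequential w →
               Sequential (i ∷ r ∷ w)

  restrict : Proc → List Σ → List Σ
  restrict p = filter (λ e → proc e ≟P p)

  Legal : List Σ → Set
  Legal w = ∀ (p : Proc) → Sequential (restrict p w)

  -- the invocation e, followed in the run by the suffix v, is pending
  -- iff no event of v is a matching response
  -- quiescent: no pending invocations
  Quiescent : List Σ → Set
  Quiescent w = ∀ (u v : List Σ) (e : Σ) → w ≡ u ++ (e ∷ v) →
                isInv e ≡ true → Any (Match e) v

record FA (Σ : Set) : Set₁ where
  field
    n      : ℕ
    m₀     : Fin n
    t      : Fin n → Σ → Fin n → Set
    final  : Fin n → Set

module _ {Σ : Set} (Q : FA Σ) where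
  open FA Q

  data Path : Fin n → List Σ → Fin n → Set where
    []  : ∀ {m} → Path m [] m
    _∷_ : ∀ {m a m' w m''} → t m a m' → Path m' w m'' → Path m (a ∷ w) m''

module Submission where

-- A legal run is quiescent exactly when its restriction to every process is
-- "complete": a sequence of invocation/matching-response pairs, with no final
-- pending invocation.  Take two runs w, w' from the initial state to the same
-- state q, with w quiescent.  By hypothesis w' has a continuation x such that
-- w' ++ x is legal and quiescent; x is also a continuation of w, and extending
-- w ++ x once more shows that w ++ x is legal.  Fix a process p.  Since the
-- p-restriction of w is complete, that of x is sequential on its own, hence
-- starts (if at all) with an invocation.  The p-restriction of w' ++ x is
-- complete, so the p-restriction of w' cannot end with a pending invocation:
-- its pending invocation would be answered by the first p-event of x, a
-- response.  Hence every restriction of w' is complete, and w' is quiescent.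

open import Defs
open import Data.List using (List; []; _∷_; _++_; filter)
open import Data.List.Properties using (filter-++; filter-accept; ∷-injectiveʳ)
open import Data.List.Membership.Propositional using (_∈_; find; lose)
open import Data.List.Membership.Propositional.Properties using (∈-filter⁺; ∈-filter⁻)
open import Data.List.Relation.Unary.Any using (here)
open import Data.Fin using (Fin)
open import Data.Product using (Σ-syntax; _×_; _,_; proj₁)
open import Data.Sum using (_⊎_; inj₁; inj₂)
open import Data.Empty using (⊥-elim)
open import Data.Bool using (true; false)
open import Level using (0ℓ)
open import Relation.Nullary using (¬_; yes; no)
open import Relation.Unary using (Pred; Decidable)
open import Relation.Binary.PropositionalEquality using (_≡_; refl; sym; trans; cong; subst)

filter-split : ∀ {S : Set} {P : Pred S 0ℓ} (P? : Decidable P) xs {ys zs i} →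
  filter P? xs ≡ ys ++ i ∷ zs →
  Σ[ us ∈ List S ] Σ[ vs ∈ List S ] (xs ≡ us ++ i ∷ vs × filter P? vs ≡ zs × P i)
filter-split P? [] {[]} ()
filter-split P? [] {_ ∷ _} ()
filter-split P? (x ∷ xs) eq with P? x
filter-split P? (x ∷ xs) {[]} refl | yes Px = [] , xs , refl , refl , Px
filter-split P? (x ∷ xs) {_ ∷ _} eq | yes _ with filter-split P? xs (∷-injectiveʳ eq)
... | us , vs , split , rest , Pi = x ∷ us , vs , cong (x ∷_) split , rest , Pi
filter-split P? (x ∷ xs) eq | no _ with filter-split P? xs eq
... | us , vs , split , rest , Pi = x ∷ us , vs , cong (x ∷_) split , rest , Pi

path-++ : ∀ {S} (Q : FA S) {m a m' b m''} →
  Path Q m a m' → Path Q m' b m'' → Path Q m (a ++ b) m''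
path-++ Q []      q = q
path-++ Q (t ∷ p) q = t ∷ path-++ Q p q

module Runs (A : Alphabet) where
  open Alphabet A

  data Complete : List Σ → Set where
    done     : Complete []
    answered : ∀ {i r w} → isInv i ≡ true → Match A i r → Complete w →
               Complete (i ∷ r ∷ w)

  EndsPending : List Σ → Set
  EndsPending s = Σ[ c ∈ List Σ ] Σ[ i ∈ Σ ] (s ≡ c ++ i ∷ [] × isInv i ≡ true)

  complete-or-pending : ∀ {s} → Sequential A s → Complete s ⊎ EndsPending s
  complete-or-pending seq-nil = inj₁ done
  complete-or-pending (seq-one {i} inv) = inj₂ ([] , i , refl , inv)
  complete-or-pending (seq-pair {i} {r} inv m s) with complete-or-pending s
  ... | inj₁ c = inj₁ (answered inv m c)
  ... | inj₂ (c , j , refl , invj) = inj₂ (i ∷ r ∷ c , j , refl , invj)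

  sequential-prefix : ∀ a {b} → Sequential A (a ++ b) → Sequential A a
  sequential-prefix []          _                   = seq-nil
  sequential-prefix (i ∷ [])    (seq-one inv)       = seq-one inv
  sequential-prefix (i ∷ [])    (seq-pair inv _ _)  = seq-one inv
  sequential-prefix (i ∷ r ∷ a) (seq-pair inv m s)  = seq-pair inv m (sequential-prefix a s)

  sequential-drop : ∀ {a b} → Complete a → Sequential A (a ++ b) → Sequential A b
  sequential-drop done                s                  = s
  sequential-drop (answered _ _ c)    (seq-pair _ _ s)   = sequential-drop c s

  ¬sequential-response : ∀ {r b} → isInv r ≡ false → ¬ Sequential A (r ∷ b)
  ¬sequential-response resp (seq-one inv)      with trans (sym inv) resp
  ... | ()
  ¬sequential-response resp (seq-pair inv _ _) with trans (sym inv) resp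
  ... | ()

  -- If a ++ b is complete and b is sequential, then a is complete: a pending
  -- invocation at the end of a would have to be answered by the head of b.
  complete-prefix : ∀ a {b} → Sequential A b → Complete (a ++ b) → Complete a
  complete-prefix [] _ _ = done
  complete-prefix (i ∷ []) sb (answered _ (_ , resp , _) _) =
    ⊥-elim (¬sequential-response resp sb)
  complete-prefix (i ∷ r ∷ a) sb (answered inv m c) = answered inv m (complete-prefix a sb c)

  complete-answers : ∀ c {e d} → Complete (c ++ e ∷ d) → isInv e ≡ true →
    Σ[ r ∈ Σ ] Σ[ d' ∈ List Σ ] (d ≡ r ∷ d' × Match A e r)
  complete-answers [] (answered _ m _) _ = _ , _ , refl , m
  complete-answers (i ∷ []) (answered _ (_ , resp , _) _) inv with trans (sym inv) resp
  ... | ()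
  complete-answers (i ∷ r ∷ c) (answered _ _ cc) inv = complete-answers c cc inv

  onProc : (p : Proc) → Decidable (λ e → proc e ≡ p)
  onProc p e = proc e ≟P p

  restrict-++ : ∀ p a b → restrict A p (a ++ b) ≡ restrict A p a ++ restrict A p b
  restrict-++ p = filter-++ (onProc p)

  legal-prefix : ∀ a {b} → Legal A (a ++ b) → Legal A a
  legal-prefix a {b} legal p =
    sequential-prefix (restrict A p a) (subst (Sequential A) (restrict-++ p a b) (legal p))

  -- In a legal quiescent run every restriction is complete: a final pending
  -- invocation of process p has no p-event after it, hence no matching response.
  restriction-complete : ∀ z → Quiescent A z → Legal A z → ∀ p → Complete (restrict A p z)
  restriction-complete z quiet legal p with complete-or-pending (legal p)
  ... | inj₁ c = c
  ... | inj₂ (c , i , eq , inv) with filter-split (onProc p) z eq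
  ... | u , v , split , nothingAfter , procI≡p
    with find (quiet u v i split inv)
  ... | r , r∈v , (_ , _ , procI≡procR , _) with
        subst (r ∈_) nothingAfter (∈-filter⁺ (onProc p) r∈v (trans (sym procI≡procR) procI≡p))
  ... | ()

  complete-quiescent : ∀ z → (∀ p → Complete (restrict A p z)) → Quiescent A z
  complete-quiescent z complete u v e split inv
    with complete-answers (restrict A (proc e) u) around inv
    where
      around : Complete (restrict A (proc e) u ++ e ∷ restrict A (proc e) v)
      around = subst Complete
        (trans (cong (restrict A (proc e)) split)
               (trans (restrict-++ (proc e) u (e ∷ v))
                      (cong (restrict A (proc e) u ++_) (filter-accept (onProc (proc e)) refl))))
        (complete (proc e))
  ... | r , _ , eq , m = lose (proj₁ (∈-filter⁻ (onProc (proc e)) (subst (r ∈_) (sym eq) (here refl)))) m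

  quiescence-transfer : ∀ w w' x → Quiescent A w → Legal A (w ++ x) →
    Quiescent A (w' ++ x) → Legal A (w' ++ x) → Quiescent A w'
  quiescence-transfer w w' x quiet legal quiet' legal' =
    complete-quiescent w' λ p → complete-prefix (restrict A p w') (continuation p)
      (subst Complete (restrict-++ p w' x) (restriction-complete (w' ++ x) quiet' legal' p))
    where
      continuation : ∀ p → Sequential A (restrict A p x)
      continuation p = sequential-drop
        (restriction-complete w quiet (legal-prefix w legal) p)
        (subst (Sequential A) (restrict-++ p w x) (legal p))

open Runs using (quiescence-transfer; legal-prefix)

mainTheorem3 : (A : Alphabet) (Q : FA (Alphabet.Σ A)) →
    (∀ {q : Fin (FA.n Q)} {w : List (Alphabet.Σ A)} → Path Q (FA.m₀ Q) w q →
    Σ[ w' ∈ List (Alphabet.Σ A) ] Σ[ q' ∈ Fin (FA.n Q) ]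
    (Path Q q w' q' × Legal A (w ++ w') × Quiescent A (w ++ w'))) →
    ∀ {q : Fin (FA.n Q)} {w : List (Alphabet.Σ A)} →
    Path Q (FA.m₀ Q) w q → Quiescent A w →
    ∀ {w' : List (Alphabet.Σ A)} → Path Q (FA.m₀ Q) w' q → Quiescent A w'
mainTheorem3 A Q extend {w = w} path quiet {w'} path'
  with extend path'
... | x , _ , continue , legal' , quiet'
  with extend (path-++ Q path continue)
... | _ , _ , _ , legal , _ =
  quiescence-transfer A w w' x quiet (legal-prefix A (w ++ x) legal) quiet' legal'
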